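{- Let $R$ be a forward terminating path and $S$ a backward terminating path such that $\mathrm{ep}(R)=\mathrm{sp}(S)$ and $R\mathbin{;}\mathsf{L}\cap(R^{\top}\mathbin{;}\mathsf{L}\cup S\mathbin{;}\mathsf{L})\cap S^{\top}\mathbin{;}\mathsf{L}=\mathsf{O}$. Then $R\cup S$ is a path, $\mathrm{sp}(R\cup S)\subseteq\mathrm{sp}(R)$ and $\mathrm{ep}(R\cup S)\subseteq\mathrm{ep}(S)$.
   Context: $(B,\cup,\mathbin{;},\overline{\,\cdot\,},{}^{\top},{}^{*},\mathsf{I})$ is a Kleene relation algebra; all variables range over $B$. That is, $(B,\cup,\mathbin{;},\overline{\,\cdot\,},{}^{\top},\mathsf{I})$ is a relation algebra: $\cup$ is associative and commutative and $R=\overline{\overline{R}\cup\overline{S}}\cup\overline{\overline{R}\cup S}$; $\mathbin{;}$ is associative, $(R\cup S)\mathbin{;}T=R\mathbin{;}T\cup S\mathbin{;}T$, $R\mathbin{;}\mathsf{I}=R$; $(R^{\top})^{\top}=R$, $(R\cup S)^{\top}=R^{\top}\cup S^{\top}$, $(R\mathbin{;}S)^{\top}=S^{\top}\mathbin{;}R^{\top}$; $R^{\top}\mathbin{;}\overline{R\mathbin{;}S}\cup\overline{S}=\overline{S}$. The order is $R\subseteq S$ iff $R\cup S=S$; $R\cap S=\overline{\overline{R}\cup\overline{S}}$; $\mathsf{L}=R\cup\overline{R}$ is the greatest and $\mathsf{O}=R\cap\overline{R}$ the least element. The star satisfies $\mathsf{I}\cup R\mathbin{;}R^*\subseteq R^*$,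 $\mathsf{I}\cup R^*\mathbin{;}R\subseteq R^*$, $S\cup R\mathbin{;}Q\subseteq Q\Rightarrow R^*\mathbin{;}S\subseteq Q$, $S\cup Q\mathbin{;}R\subseteq Q\Rightarrow S\mathbin{;}R^*\subseteq Q$. Write $R^{\top*}=(R^{\top})^*$. The algebra satisfies the Tarski rule ($R\neq\mathsf{O}$ iff $\mathsf{L}\mathbin{;}R\mathbin{;}\mathsf{L}=\mathsf{L}$) and the point axiom (for every $R\neq\mathsf{O}$ there are points $p,q$ with $p\mathbin{;}q^{\top}\subseteq R$), where a point is an element $p$ with $p=p\mathbin{;}\mathsf{L}$, $p\mathbin{;}p^{\top}\subseteq\mathsf{I}$ and $\mathsf{I}\subseteq p^{\top}\mathbin{;}p$. Composition binds tighter than $\cup,\cap$; complement and converse bind tighter than composition. $R$ is univalent if $R^{\top}\mathbin{;}R\subseteq\mathsf{I}$ and injective if $R\mathbin{;}R^{\top}\subseteq\mathsf{I}$. $R$ is connected if $R\mathbin{;}\mathsf{L}\mathbin{;}R\subseteq R^*\cup R^{\top*}$; $R$ is a path if it is injective, univalent and connected. $\mathrm{sp}(R)=R\mathbin{;}\mathsf{L}\cap\overline{R^{\top}\mathbin{;}\mathsf{L}}$ and $\mathrm{ep}(R)=R^{\top}\mathbin{;}\mathsf{L}\cap\overline{R\mathbin{;}\mathsf{L}}$. A path $R$ is backward terminating if $\mathrm{sp}(R)\neq\mathsf{O}$ or $R=\mathsf{O}$; forward terminating if $\mathrm{ep}(R)\neq\mathsf{O}$ or $R=\mathsf{O}$.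 -}

module Defs where

open import Level using (Level; suc)
open import Relation.Binary.PropositionalEquality using (_≡_)
open import Relation.Nullary using (¬_)
open import Data.Product using (Σ; _×_)
import Data.Sum

record KleeneRelAlg (ℓ : Level) : Set (suc ℓ) where
  infixl 6 _∪_ _∩_
  infixl 7 _⨾_
  infix 4 _⊆_
  field
    Carrier : Set ℓ
    _∪_ : Carrier → Carrier → Carrier
    _⨾_ : Carrier → Carrier → Carrier
    ∁   : Carrier → Carrier
    _ᵀ  : Carrier → Carrier
    _*  : Carrier → Carrier
    I   : Carrier

  _⊆_ : Carrier → Carrier → Set ℓ
  R ⊆ S = R ∪ S ≡ S

  _∩_ : Carrier → Carrier → Carrier
  R ∩ S = ∁ (∁ R ∪ ∁ S)

  field
    ∪-assoc : ∀ R S T → (R ∪ S) ∪ T ≡ R ∪ (S ∪ T)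
    ∪-comm  : ∀ R S → R ∪ S ≡ S ∪ R
    huntington : ∀ R S → R ≡ ∁ (∁ R ∪ ∁ S) ∪ ∁ (∁ R ∪ S)
    ⨾-assoc : ∀ R S T → (R ⨾ S) ⨾ T ≡ R ⨾ (S ⨾ T)
    ⨾-distribʳ : ∀ R S T → (R ∪ S) ⨾ T ≡ R ⨾ T ∪ S ⨾ T
    ⨾-identityʳ : ∀ R → R ⨾ I ≡ R
    ᵀ-involutive : ∀ R → (R ᵀ) ᵀ ≡ R
    ᵀ-∪ : ∀ R S → (R ∪ S) ᵀ ≡ R ᵀ ∪ S ᵀ
    ᵀ-⨾ : ∀ R S → (R ⨾ S) ᵀ ≡ S ᵀ ⨾ R ᵀ
    schroeder : ∀ R S → R ᵀ ⨾ ∁ (R ⨾ S) ∪ ∁ S ≡ ∁ S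
    *-unfoldˡ : ∀ R → (I ∪ R ⨾ (R *)) ⊆ (R *)
    *-unfoldʳ : ∀ R → (I ∪ (R *) ⨾ R) ⊆ (R *)
    *-inductˡ : ∀ R S Q → (S ∪ R ⨾ Q) ⊆ Q → ((R *) ⨾ S) ⊆ Q
    *-inductʳ : ∀ R S Q → (S ∪ Q ⨾ R) ⊆ Q → (S ⨾ (R *)) ⊆ Q

  L : Carrier
  L = I ∪ ∁ I

  O : Carrier
  O = I ∩ ∁ I

  IsPoint : Carrier → Set ℓ
  IsPoint p = (p ≡ p ⨾ L) × ((p ⨾ (p ᵀ)) ⊆ I) × (I ⊆ ((p ᵀ) ⨾ p))

  field
    tarski : ∀ R → (¬ (R ≡ O) → L ⨾ R ⨾ L ≡ L) × (L ⨾ R ⨾ L ≡ L → ¬ (R ≡ O))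
    point-axiom : ∀ R → ¬ (R ≡ O) →
      Σ Carrier λ p → Σ Carrier λ q → IsPoint p × IsPoint q × ((p ⨾ (q ᵀ)) ⊆ R)

  Univalent : Carrier → Set ℓ
  Univalent R = ((R ᵀ) ⨾ R) ⊆ I

  Injective : Carrier → Set ℓ
  Injective R = (R ⨾ (R ᵀ)) ⊆ I

  Connected : Carrier → Set ℓ
  Connected R = (R ⨾ L ⨾ R) ⊆ ((R *) ∪ ((R ᵀ) *))

  IsPath : Carrier → Set ℓ
  IsPath R = Injective R × Univalent R × Connected R

  sp : Carrier → Carrier
  sp R = R ⨾ L ∩ ∁ ((R ᵀ) ⨾ L)

  ep : Carrier → Carrier
  ep R = (R ᵀ) ⨾ L ∩ ∁ (R ⨾ L)

  BackwardTerminating : Carrier → Set ℓ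
  BackwardTerminating R = IsPath R × (¬ (sp R ≡ O) Data.Sum.⊎ (R ≡ O))

  ForwardTerminating : Carrier → Set ℓ
  ForwardTerminating R = IsPath R × (¬ (ep R ≡ O) Data.Sum.⊎ (R ≡ O))

-- The hypothesis together with ep R = sp S (which lies in S ⨾ L but outside R ⨾ L) makes
-- the domains R ⨾ L, S ⨾ L and the ranges R ᵀ ⨾ L, S ᵀ ⨾ L of the two paths disjoint, so
-- R ∪ S stays univalent and injective. For connectedness only the mixed terms R ⨾ L ⨾ S and
-- S ⨾ L ⨾ R are new. In a forward terminating path every point of the domain or range reaches
-- the end point along R: connectedness relates it to ep R in some direction, and the Tarski
-- rule turns ep R ≠ O into L ⨾ ep R = L. Dually sp S reaches every point of S. As ep R = sp S
-- is an injective vector (at most one point), the two walks compose to a walk in R ∪ S.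
-- The claims about sp and ep are Boolean computations with the four vectors above.

module Submission where

open import Defs
open import Level using (Level)
open import Relation.Binary.PropositionalEquality
  using (_≡_; refl; sym; trans; cong; cong₂; subst₂; isEquivalence; module ≡-Reasoning)
open import Relation.Binary.Definitions using (Reflexive; Transitive)
open import Relation.Binary.Reasoning.Syntax using (module ⊆-syntax)
open import Data.Product using (_×_; _,_; proj₁; proj₂)
open import Data.Sum using (_⊎_; inj₁; inj₂)
open import Relation.Nullary using (¬_)
open import Algebra.Bundles using (CommutativeSemigroup; Monoid)
import Algebra.Solver.Monoid as MonoidSolver
import Algebra.Properties.CommutativeSemigroup as CommSemigroupProperties

module Properties {ℓ : Level} (A : KleeneRelAlg ℓ) where
  open KleeneRelAlg A

  -- Boolean algebra from Huntington's axiom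
  ∪-commutativeSemigroup : CommutativeSemigroup ℓ ℓ
  ∪-commutativeSemigroup = record
    { _∙_ = _∪_
    ; isCommutativeSemigroup = record
      { isSemigroup = record
        { isMagma = record { isEquivalence = isEquivalence ; ∙-cong = cong₂ _∪_ }
        ; assoc = ∪-assoc }
      ; comm = ∪-comm } }

  open CommSemigroupProperties ∪-commutativeSemigroup
    using (interchange; x∙yz≈y∙xz)

  ∩-comm : ∀ x y → x ∩ y ≡ y ∩ x
  ∩-comm x y = cong ∁ (∪-comm (∁ x) (∁ y))

  split : ∀ x y → x ≡ (x ∩ ∁ y) ∪ (x ∩ y)
  split x y = huntington x (∁ y)

  swap-outer : ∀ a b c d → (a ∪ b) ∪ (c ∪ d) ≡ (d ∪ b) ∪ (c ∪ a)
  swap-outer a b c d = begin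
    (a ∪ b) ∪ (c ∪ d)  ≡⟨ interchange a b c d ⟩
    (a ∪ c) ∪ (b ∪ d)  ≡⟨ ∪-comm _ _ ⟩
    (b ∪ d) ∪ (a ∪ c)  ≡⟨ cong₂ _∪_ (∪-comm b d) (∪-comm a c) ⟩
    (d ∪ b) ∪ (c ∪ a)  ∎
    where open ≡-Reasoning

  x∪∁x≡y∪∁y : ∀ x y → x ∪ ∁ x ≡ y ∪ ∁ y
  x∪∁x≡y∪∁y x y = begin
    x ∪ ∁ x
      ≡⟨ cong₂ _∪_ (split x y) (split (∁ x) y) ⟩
    ((x ∩ ∁ y) ∪ (x ∩ y)) ∪ ((∁ x ∩ ∁ y) ∪ (∁ x ∩ y))
      ≡⟨ swap-outer _ _ _ _ ⟩
    ((∁ x ∩ y) ∪ (x ∩ y)) ∪ ((∁ x ∩ ∁ y) ∪ (x ∩ ∁ y))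
      ≡⟨ cong₂ _∪_ (cong₂ _∪_ (∩-comm (∁ x) y) (∩-comm x y))
                   (cong₂ _∪_ (∩-comm (∁ x) (∁ y)) (∩-comm x (∁ y))) ⟩
    ((y ∩ ∁ x) ∪ (y ∩ x)) ∪ ((∁ y ∩ ∁ x) ∪ (∁ y ∩ x))
      ≡⟨ cong₂ _∪_ (split y x) (split (∁ y) x) ⟨
    y ∪ ∁ y ∎
    where open ≡-Reasoning

  ∁-involutive : ∀ x → ∁ (∁ x) ≡ x
  ∁-involutive x = begin
    ∁ (∁ x)                                   ≡⟨ ∁x-expansion (∁ x) ⟩
    ∁ (∁ x ∪ ∁ (∁ (∁ x))) ∪ ∁ (∁ x ∪ ∁ (∁ x))  ≡⟨ huntington x (∁ (∁ x)) ⟨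
    x                                         ∎
    where
    open ≡-Reasoning
    ∁x-expansion : ∀ y → ∁ y ≡ ∁ (y ∪ ∁ (∁ y)) ∪ ∁ (y ∪ ∁ y)
    ∁x-expansion y = begin
      ∁ y                                       ≡⟨ huntington (∁ y) y ⟩
      ∁ (∁ (∁ y) ∪ ∁ y) ∪ ∁ (∁ (∁ y) ∪ y)        ≡⟨ ∪-comm _ _ ⟩
      ∁ (∁ (∁ y) ∪ y) ∪ ∁ (∁ (∁ y) ∪ ∁ y)        ≡⟨ cong₂ (λ u v → ∁ u ∪ ∁ v)
                                                    (∪-comm (∁ (∁ y)) y)
                                                    (trans (∪-comm _ _) (x∪∁x≡y∪∁y (∁ y) y)) ⟩
      ∁ (y ∪ ∁ (∁ y)) ∪ ∁ (y ∪ ∁ y)              ∎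

  x∪∁x≡L : ∀ x → x ∪ ∁ x ≡ L
  x∪∁x≡L x = x∪∁x≡y∪∁y x I

  ∁-∪ : ∀ x y → ∁ (x ∪ y) ≡ ∁ x ∩ ∁ y
  ∁-∪ x y = cong ∁ (sym (cong₂ _∪_ (∁-involutive x) (∁-involutive y)))

  ∁L≡O : ∁ L ≡ O
  ∁L≡O = cong ∁ (sym (x∪∁x≡L (∁ I)))

  x∩∁x≡O : ∀ x → x ∩ ∁ x ≡ O
  x∩∁x≡O x = trans (cong ∁ (x∪∁x≡L (∁ x))) ∁L≡O

  ∁O≡L : ∁ O ≡ L
  ∁O≡L = trans (cong ∁ (sym ∁L≡O)) (∁-involutive L)

  O∪L≡L : O ∪ L ≡ L
  O∪L≡L = trans (cong (O ∪_) (sym ∁O≡L)) (x∪∁x≡L O)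

  x≡O∪x∩x : ∀ x → x ≡ O ∪ (x ∩ x)
  x≡O∪x∩x x = trans (split x x) (cong (_∪ (x ∩ x)) (x∩∁x≡O x))

  ∁x≡O∪∁[x∪x] : ∀ x → ∁ x ≡ O ∪ ∁ (x ∪ x)
  ∁x≡O∪∁[x∪x] x = trans (x≡O∪x∩x (∁ x)) (cong (O ∪_) (sym (∁-∪ x x)))

  ∪-zeroʳ : ∀ x → x ∪ L ≡ L
  ∪-zeroʳ x = begin
    x ∪ L                           ≡⟨ cong (x ∪_) (x∪∁x≡L x) ⟨
    x ∪ (x ∪ ∁ x)                   ≡⟨ ∪-assoc x x (∁ x) ⟨
    (x ∪ x) ∪ ∁ x                   ≡⟨ cong ((x ∪ x) ∪_) (∁x≡O∪∁[x∪x] x) ⟩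
    (x ∪ x) ∪ (O ∪ ∁ (x ∪ x))       ≡⟨ x∙yz≈y∙xz (x ∪ x) O _ ⟩
    O ∪ ((x ∪ x) ∪ ∁ (x ∪ x))       ≡⟨ cong (O ∪_) (x∪∁x≡L (x ∪ x)) ⟩
    O ∪ L                           ≡⟨ O∪L≡L ⟩
    L                               ∎
    where open ≡-Reasoning

  x∪x≡x∪O : ∀ x → x ∪ x ≡ x ∪ O
  x∪x≡x∪O x = begin
    x ∪ x                                   ≡⟨ split (x ∪ x) O ⟩
    ((x ∪ x) ∩ ∁ O) ∪ ((x ∪ x) ∩ O)         ≡⟨ cong₂ _∪_ left right ⟩
    x ∪ O                                   ∎
    where
    open ≡-Reasoning
    left : (x ∪ x) ∩ ∁ O ≡ x
    left = begin
      ∁ (∁ (x ∪ x) ∪ ∁ (∁ O))   ≡⟨ cong (λ u → ∁ (∁ (x ∪ x) ∪ u)) (∁-involutive O) ⟩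
      ∁ (∁ (x ∪ x) ∪ O)         ≡⟨ cong ∁ (∪-comm _ O) ⟩
      ∁ (O ∪ ∁ (x ∪ x))         ≡⟨ cong ∁ (∁x≡O∪∁[x∪x] x) ⟨
      ∁ (∁ x)                   ≡⟨ ∁-involutive x ⟩
      x                         ∎
    right : (x ∪ x) ∩ O ≡ O
    right = trans (cong (λ u → ∁ (∁ (x ∪ x) ∪ u)) ∁O≡L) (trans (cong ∁ (∪-zeroʳ _)) ∁L≡O)

  O∪O≡O : O ∪ O ≡ O
  O∪O≡O = sym (trans (x≡O∪x∩x O) (cong (O ∪_) O∩O≡O))
    where
    O∩O≡O : O ∩ O ≡ O
    O∩O≡O = trans (cong ∁ (trans (cong₂ _∪_ ∁O≡L ∁O≡L) (∪-zeroʳ L))) ∁L≡O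

  ∪-identityʳ : ∀ x → x ∪ O ≡ x
  ∪-identityʳ x = begin
    x ∪ O                    ≡⟨ cong (_∪ O) (x≡O∪x∩x x) ⟩
    (O ∪ (x ∩ x)) ∪ O        ≡⟨ cong (_∪ O) (∪-comm O _) ⟩
    ((x ∩ x) ∪ O) ∪ O        ≡⟨ ∪-assoc _ O O ⟩
    (x ∩ x) ∪ (O ∪ O)        ≡⟨ cong ((x ∩ x) ∪_) O∪O≡O ⟩
    (x ∩ x) ∪ O              ≡⟨ ∪-comm _ O ⟩
    O ∪ (x ∩ x)              ≡⟨ x≡O∪x∩x x ⟨
    x                        ∎
    where open ≡-Reasoning

  ∪-idem : ∀ x → x ∪ x ≡ x
  ∪-idem x = trans (x∪x≡x∪O x) (∪-identityʳ x)

  ∪-absorbs-∩ : ∀ x y → x ∪ (x ∩ y) ≡ x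
  ∪-absorbs-∩ x y = begin
    x ∪ (x ∩ y)                              ≡⟨ cong (_∪ (x ∩ y)) (split x y) ⟩
    ((x ∩ ∁ y) ∪ (x ∩ y)) ∪ (x ∩ y)          ≡⟨ ∪-assoc _ _ _ ⟩
    (x ∩ ∁ y) ∪ ((x ∩ y) ∪ (x ∩ y))          ≡⟨ cong ((x ∩ ∁ y) ∪_) (∪-idem _) ⟩
    (x ∩ ∁ y) ∪ (x ∩ y)                      ≡⟨ split x y ⟨
    x                                        ∎
    where open ≡-Reasoning

  ∪-∁∩ : ∀ x y → x ∪ (∁ x ∩ y) ≡ x ∪ y
  ∪-∁∩ x y = begin
    x ∪ (∁ x ∩ y)                      ≡⟨ cong (_∪ (∁ x ∩ y)) (∪-absorbs-∩ x y) ⟨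
    (x ∪ (x ∩ y)) ∪ (∁ x ∩ y)          ≡⟨ ∪-assoc _ _ _ ⟩
    x ∪ ((x ∩ y) ∪ (∁ x ∩ y))          ≡⟨ cong (x ∪_) (cong₂ _∪_ (∩-comm x y) (∩-comm (∁ x) y)) ⟩
    x ∪ ((y ∩ x) ∪ (y ∩ ∁ x))          ≡⟨ cong (x ∪_) (∪-comm _ _) ⟩
    x ∪ ((y ∩ ∁ x) ∪ (y ∩ x))          ≡⟨ cong (x ∪_) (split y x) ⟨
    x ∪ y                              ∎
    where open ≡-Reasoning

  -- The inclusion order
  ⊆-reflexive : ∀ {x y} → x ≡ y → x ⊆ y
  ⊆-reflexive {x} refl = ∪-idem x

  ⊆-refl : Reflexive _⊆_
  ⊆-refl = ⊆-reflexive refl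

  ⊆-trans : Transitive _⊆_
  ⊆-trans {x} {y} {z} x⊆y y⊆z = begin
    x ∪ z          ≡⟨ cong (x ∪_) y⊆z ⟨
    x ∪ (y ∪ z)    ≡⟨ ∪-assoc x y z ⟨
    (x ∪ y) ∪ z    ≡⟨ cong (_∪ z) x⊆y ⟩
    y ∪ z          ≡⟨ y⊆z ⟩
    z              ∎
    where open ≡-Reasoning

  ⊆-antisym : ∀ {x y} → x ⊆ y → y ⊆ x → x ≡ y
  ⊆-antisym {x} {y} x⊆y y⊆x = trans (sym y⊆x) (trans (∪-comm y x) x⊆y)

  module ⊆-Reasoning where
    open import Relation.Binary.Reasoning.Base.Single _⊆_ ⊆-refl ⊆-trans public
    open ⊆-syntax _IsRelatedTo_ _IsRelatedTo_ ∼-go public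

  x⊆x∪y : ∀ x y → x ⊆ x ∪ y
  x⊆x∪y x y = trans (sym (∪-assoc x x y)) (cong (_∪ y) (∪-idem x))

  y⊆x∪y : ∀ x y → y ⊆ x ∪ y
  y⊆x∪y x y = subst₂ _⊆_ refl (∪-comm y x) (x⊆x∪y y x)

  ∪-least : ∀ {x y z} → x ⊆ z → y ⊆ z → x ∪ y ⊆ z
  ∪-least {x} {y} {z} x⊆z y⊆z = trans (∪-assoc x y z) (trans (cong (x ∪_) y⊆z) x⊆z)

  ∪-mono : ∀ {a b c d} → a ⊆ b → c ⊆ d → a ∪ c ⊆ b ∪ d
  ∪-mono {b = b} {d = d} a⊆b c⊆d =
    ∪-least (⊆-trans a⊆b (x⊆x∪y b d)) (⊆-trans c⊆d (y⊆x∪y b d))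

  x⊆L : ∀ x → x ⊆ L
  x⊆L = ∪-zeroʳ

  O⊆x : ∀ x → O ⊆ x
  O⊆x x = trans (∪-comm O x) (∪-identityʳ x)

  ⊆O⇒≡O : ∀ {x} → x ⊆ O → x ≡ O
  ⊆O⇒≡O x⊆O = ⊆-antisym x⊆O (O⊆x _)

  ∁-antitone : ∀ {x y} → x ⊆ y → ∁ y ⊆ ∁ x
  ∁-antitone {x} {y} x⊆y = begin
    ∁ y ∪ ∁ x                ≡⟨ cong (λ u → ∁ u ∪ ∁ x) x⊆y ⟨
    ∁ (x ∪ y) ∪ ∁ x          ≡⟨ cong (_∪ ∁ x) (∁-∪ x y) ⟩
    (∁ x ∩ ∁ y) ∪ ∁ x        ≡⟨ ∪-comm _ _ ⟩
    ∁ x ∪ (∁ x ∩ ∁ y)        ≡⟨ ∪-absorbs-∩ (∁ x) (∁ y) ⟩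
    ∁ x                      ∎
    where open ≡-Reasoning

  ∁-swapˡ : ∀ {x y} → ∁ x ⊆ y → ∁ y ⊆ x
  ∁-swapˡ {x} {y} ∁x⊆y = subst₂ _⊆_ refl (∁-involutive x) (∁-antitone ∁x⊆y)

  ∁-swapʳ : ∀ {x y} → x ⊆ ∁ y → y ⊆ ∁ x
  ∁-swapʳ {x} {y} x⊆∁y = subst₂ _⊆_ (∁-involutive y) refl (∁-antitone x⊆∁y)

  x∩y⊆x : ∀ x y → x ∩ y ⊆ x
  x∩y⊆x x y = ∁-swapˡ (x⊆x∪y (∁ x) (∁ y))

  x∩y⊆y : ∀ x y → x ∩ y ⊆ y
  x∩y⊆y x y = ∁-swapˡ (y⊆x∪y (∁ x) (∁ y))

  ∩-greatest : ∀ {x y z} → z ⊆ x → z ⊆ y → z ⊆ x ∩ y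
  ∩-greatest z⊆x z⊆y = ∁-swapʳ (∪-least (∁-antitone z⊆x) (∁-antitone z⊆y))

  ∩-mono : ∀ {a b c d} → a ⊆ b → c ⊆ d → a ∩ c ⊆ b ∩ d
  ∩-mono {a} {c = c} a⊆b c⊆d =
    ∩-greatest (⊆-trans (x∩y⊆x a c) a⊆b) (⊆-trans (x∩y⊆y a c) c⊆d)

  ∩-idem : ∀ x → x ∩ x ≡ x
  ∩-idem x = ⊆-antisym (x∩y⊆x x x) (∩-greatest ⊆-refl ⊆-refl)

  ∩-identityʳ : ∀ x → x ∩ L ≡ x
  ∩-identityʳ x = ⊆-antisym (x∩y⊆x x L) (∩-greatest ⊆-refl (x⊆L x))

  ∩-assoc : ∀ x y z → (x ∩ y) ∩ z ≡ x ∩ (y ∩ z)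
  ∩-assoc x y z = cong ∁ (begin
    ∁ (∁ (∁ x ∪ ∁ y)) ∪ ∁ z     ≡⟨ cong (_∪ ∁ z) (∁-involutive _) ⟩
    (∁ x ∪ ∁ y) ∪ ∁ z           ≡⟨ ∪-assoc _ _ _ ⟩
    ∁ x ∪ (∁ y ∪ ∁ z)           ≡⟨ cong (∁ x ∪_) (∁-involutive _) ⟨
    ∁ x ∪ ∁ (∁ (∁ y ∪ ∁ z))     ∎)
    where open ≡-Reasoning

  [x∪y]∩∁x⊆y : ∀ x y → (x ∪ y) ∩ ∁ x ⊆ y
  [x∪y]∩∁x⊆y x y = ∁-swapˡ (begin
    ∁ y                        ⊆⟨ y⊆x∪y x (∁ y) ⟩
    x ∪ ∁ y                    ≡⟨ ∪-∁∩ x (∁ y) ⟨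
    x ∪ (∁ x ∩ ∁ y)            ≡⟨ cong (x ∪_) (∁-∪ x y) ⟨
    x ∪ ∁ (x ∪ y)              ≡⟨ ∪-comm _ _ ⟩
    ∁ (x ∪ y) ∪ x              ≡⟨ cong (∁ (x ∪ y) ∪_) (∁-involutive x) ⟨
    ∁ (x ∪ y) ∪ ∁ (∁ x)        ∎)
    where open ⊆-Reasoning

  ∩-distribˡ-∪ : ∀ x y z → x ∩ (y ∪ z) ≡ (x ∩ y) ∪ (x ∩ z)
  ∩-distribˡ-∪ x y z = ⊆-antisym
    (begin
      x ∩ (y ∪ z)                                          ≡⟨ split (x ∩ (y ∪ z)) y ⟩
      ((x ∩ (y ∪ z)) ∩ ∁ y) ∪ ((x ∩ (y ∪ z)) ∩ y)         ⊆⟨ ∪-mono outside-y inside-y ⟩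
      (x ∩ z) ∪ (x ∩ y)                                    ≡⟨ ∪-comm _ _ ⟩
      (x ∩ y) ∪ (x ∩ z)                                    ∎)
    (∪-least (∩-mono ⊆-refl (x⊆x∪y y z)) (∩-mono ⊆-refl (y⊆x∪y y z)))
    where
    open ⊆-Reasoning
    inside-y : (x ∩ (y ∪ z)) ∩ y ⊆ x ∩ y
    inside-y = ∩-mono (x∩y⊆x x _) ⊆-refl
    outside-y : (x ∩ (y ∪ z)) ∩ ∁ y ⊆ x ∩ z
    outside-y = ∩-greatest (⊆-trans (x∩y⊆x _ _) (x∩y⊆x x _))
                           (⊆-trans (∩-mono (x∩y⊆y x _) ⊆-refl) ([x∪y]∩∁x⊆y y z))

  ∩⊆⇒⊆∁∪ : ∀ {x y z} → x ∩ y ⊆ z → x ⊆ ∁ y ∪ z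
  ∩⊆⇒⊆∁∪ {x} {y} {z} x∩y⊆z = begin
    x                          ≡⟨ split x y ⟩
    (x ∩ ∁ y) ∪ (x ∩ y)        ⊆⟨ ∪-mono (x∩y⊆y x (∁ y)) x∩y⊆z ⟩
    ∁ y ∪ z                    ∎
    where open ⊆-Reasoning

  ⊆∁∪⇒∩⊆ : ∀ {x y z} → x ⊆ ∁ y ∪ z → x ∩ y ⊆ z
  ⊆∁∪⇒∩⊆ {x} {y} {z} x⊆∁y∪z = begin
    x ∩ y                      ⊆⟨ ∩-mono x⊆∁y∪z ⊆-refl ⟩
    (∁ y ∪ z) ∩ y              ≡⟨ ∩-comm _ y ⟩
    y ∩ (∁ y ∪ z)              ≡⟨ ∩-distribˡ-∪ y (∁ y) z ⟩
    (y ∩ ∁ y) ∪ (y ∩ z)        ≡⟨ cong (_∪ (y ∩ z)) (x∩∁x≡O y) ⟩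
    O ∪ (y ∩ z)                ⊆⟨ ∪-least (O⊆x z) (x∩y⊆y y z) ⟩
    z                          ∎
    where open ⊆-Reasoning

  disjoint⇒⊆∁ : ∀ {x y} → x ∩ y ⊆ O → x ⊆ ∁ y
  disjoint⇒⊆∁ {y = y} x∩y⊆O = ⊆-trans (∩⊆⇒⊆∁∪ x∩y⊆O) (⊆-reflexive (∪-identityʳ (∁ y)))

  ⊆O-by-cases : ∀ {x} y → x ∩ ∁ y ⊆ O → x ∩ y ⊆ O → x ⊆ O
  ⊆O-by-cases {x} y outside inside = subst₂ _⊆_ (sym (split x y)) refl (∪-least outside inside)

  ∪-difference⊆ : ∀ {x y z w} → z ∩ ∁ w ⊆ y → (x ∪ z) ∩ ∁ (y ∪ w) ⊆ x ∩ ∁ y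
  ∪-difference⊆ {x} {y} {z} {w} z∖w⊆y = ∩-greatest X⊆x X⊆∁y
    where
    open ⊆-Reasoning
    X : Carrier
    X = (x ∪ z) ∩ ∁ (y ∪ w)
    X⊆∁y : X ⊆ ∁ y
    X⊆∁y = ⊆-trans (x∩y⊆y _ _) (∁-antitone (x⊆x∪y y w))
    X⊆∁w : X ⊆ ∁ w
    X⊆∁w = ⊆-trans (x∩y⊆y _ _) (∁-antitone (y⊆x∪y y w))
    X∖x⊆z : X ∩ ∁ x ⊆ z
    X∖x⊆z = ⊆-trans (∩-mono (x∩y⊆x _ _) ⊆-refl) ([x∪y]∩∁x⊆y x z)
    X⊆x : X ⊆ x
    X⊆x = subst₂ _⊆_ refl (∁-involutive x) (disjoint⇒⊆∁ (begin
      X ∩ ∁ x            ⊆⟨ ∩-greatest (∩-greatest X∖x⊆z (⊆-trans (x∩y⊆x _ _) X⊆∁w))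
                                       (⊆-trans (x∩y⊆x _ _) X⊆∁y) ⟩
      (z ∩ ∁ w) ∩ ∁ y    ⊆⟨ ∩-mono z∖w⊆y ⊆-refl ⟩
      y ∩ ∁ y            ≡⟨ x∩∁x≡O y ⟩
      O                  ∎))

  -- Composition and converse
  ⨾-monoˡ : ∀ {x y} z → x ⊆ y → x ⨾ z ⊆ y ⨾ z
  ⨾-monoˡ {x} {y} z x⊆y = trans (sym (⨾-distribʳ x y z)) (cong (_⨾ z) x⊆y)

  ᵀ-mono : ∀ {x y} → x ⊆ y → x ᵀ ⊆ y ᵀ
  ᵀ-mono {x} {y} x⊆y = trans (sym (ᵀ-∪ x y)) (cong _ᵀ x⊆y)

  ᵀ-reflects-⊆ : ∀ {x y} → x ᵀ ⊆ y ᵀ → x ⊆ y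
  ᵀ-reflects-⊆ {x} {y} xᵀ⊆yᵀ = subst₂ _⊆_ (ᵀ-involutive x) (ᵀ-involutive y) (ᵀ-mono xᵀ⊆yᵀ)

  ᵀ-⨾-ᵀ : ∀ x y → (y ᵀ ⨾ x ᵀ) ᵀ ≡ x ⨾ y
  ᵀ-⨾-ᵀ x y = trans (ᵀ-⨾ (y ᵀ) (x ᵀ)) (cong₂ _⨾_ (ᵀ-involutive x) (ᵀ-involutive y))

  Iᵀ≡I : I ᵀ ≡ I
  Iᵀ≡I = begin
    I ᵀ              ≡⟨ ⨾-identityʳ (I ᵀ) ⟨
    I ᵀ ⨾ I          ≡⟨ cong (I ᵀ ⨾_) (ᵀ-involutive I) ⟨
    I ᵀ ⨾ I ᵀ ᵀ      ≡⟨ ᵀ-⨾ (I ᵀ) I ⟨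
    (I ᵀ ⨾ I) ᵀ      ≡⟨ cong _ᵀ (⨾-identityʳ (I ᵀ)) ⟩
    I ᵀ ᵀ            ≡⟨ ᵀ-involutive I ⟩
    I                ∎
    where open ≡-Reasoning

  ⨾-identityˡ : ∀ x → I ⨾ x ≡ x
  ⨾-identityˡ x = begin
    I ⨾ x             ≡⟨ ᵀ-⨾-ᵀ I x ⟨
    (x ᵀ ⨾ I ᵀ) ᵀ     ≡⟨ cong (λ u → (x ᵀ ⨾ u) ᵀ) Iᵀ≡I ⟩
    (x ᵀ ⨾ I) ᵀ       ≡⟨ cong _ᵀ (⨾-identityʳ (x ᵀ)) ⟩
    x ᵀ ᵀ             ≡⟨ ᵀ-involutive x ⟩
    x                 ∎
    where open ≡-Reasoning

  ⨾-monoid : Monoid ℓ ℓ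
  ⨾-monoid = record
    { _∙_ = _⨾_
    ; ε = I
    ; isMonoid = record
      { isSemigroup = record
        { isMagma = record { isEquivalence = isEquivalence ; ∙-cong = cong₂ _⨾_ }
        ; assoc = ⨾-assoc }
      ; identity = ⨾-identityˡ , ⨾-identityʳ } }

  module ⨾-Solver = MonoidSolver ⨾-monoid

  ⨾-distribˡ : ∀ x y z → x ⨾ (y ∪ z) ≡ x ⨾ y ∪ x ⨾ z
  ⨾-distribˡ x y z = begin
    x ⨾ (y ∪ z)                      ≡⟨ ᵀ-⨾-ᵀ x (y ∪ z) ⟨
    ((y ∪ z) ᵀ ⨾ x ᵀ) ᵀ              ≡⟨ cong (λ u → (u ⨾ x ᵀ) ᵀ) (ᵀ-∪ y z) ⟩
    ((y ᵀ ∪ z ᵀ) ⨾ x ᵀ) ᵀ            ≡⟨ cong _ᵀ (⨾-distribʳ (y ᵀ) (z ᵀ) (x ᵀ)) ⟩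
    (y ᵀ ⨾ x ᵀ ∪ z ᵀ ⨾ x ᵀ) ᵀ        ≡⟨ ᵀ-∪ _ _ ⟩
    (y ᵀ ⨾ x ᵀ) ᵀ ∪ (z ᵀ ⨾ x ᵀ) ᵀ    ≡⟨ cong₂ _∪_ (ᵀ-⨾-ᵀ x y) (ᵀ-⨾-ᵀ x z) ⟩
    x ⨾ y ∪ x ⨾ z                    ∎
    where open ≡-Reasoning

  ⨾-monoʳ : ∀ {x y} z → x ⊆ y → z ⨾ x ⊆ z ⨾ y
  ⨾-monoʳ {x} {y} z x⊆y = trans (sym (⨾-distribˡ z x y)) (cong (z ⨾_) x⊆y)

  ⨾-mono : ∀ {a b c d} → a ⊆ b → c ⊆ d → a ⨾ c ⊆ b ⨾ d
  ⨾-mono {b = b} {c} a⊆b c⊆d = ⊆-trans (⨾-monoˡ c a⊆b) (⨾-monoʳ b c⊆d)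

  ⨾-distrib-∪ : ∀ w x y z → (w ∪ x) ⨾ (y ∪ z) ≡ (w ⨾ y ∪ w ⨾ z) ∪ (x ⨾ y ∪ x ⨾ z)
  ⨾-distrib-∪ w x y z = trans (⨾-distribʳ w x _) (cong₂ _∪_ (⨾-distribˡ w y z) (⨾-distribˡ x y z))

  Lᵀ≡L : L ᵀ ≡ L
  Lᵀ≡L = ⊆-antisym (x⊆L _) (subst₂ _⊆_ (ᵀ-involutive L) refl (ᵀ-mono (x⊆L (L ᵀ))))

  Oᵀ≡O : O ᵀ ≡ O
  Oᵀ≡O = ⊆O⇒≡O (subst₂ _⊆_ refl (ᵀ-involutive O) (ᵀ-mono (O⊆x (O ᵀ))))

  ᵀ⊆O⇒⊆O : ∀ {x} → x ᵀ ⊆ O → x ⊆ O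
  ᵀ⊆O⇒⊆O {x} xᵀ⊆O = ᵀ-reflects-⊆ (subst₂ _⊆_ refl (sym Oᵀ≡O) xᵀ⊆O)

  ᵀ-∩ : ∀ x y → (x ∩ y) ᵀ ≡ x ᵀ ∩ y ᵀ
  ᵀ-∩ x y = ⊆-antisym (ᵀ-∩⊆ x y) (ᵀ-reflects-⊆ (begin
    (x ᵀ ∩ y ᵀ) ᵀ        ⊆⟨ ᵀ-∩⊆ (x ᵀ) (y ᵀ) ⟩
    x ᵀ ᵀ ∩ y ᵀ ᵀ        ≡⟨ cong₂ _∩_ (ᵀ-involutive x) (ᵀ-involutive y) ⟩
    x ∩ y                ≡⟨ ᵀ-involutive _ ⟨
    (x ∩ y) ᵀ ᵀ          ∎))
    where
    open ⊆-Reasoning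
    ᵀ-∩⊆ : ∀ a b → (a ∩ b) ᵀ ⊆ a ᵀ ∩ b ᵀ
    ᵀ-∩⊆ a b = ∩-greatest (ᵀ-mono (x∩y⊆x a b)) (ᵀ-mono (x∩y⊆y a b))

  ᵀ-∁ : ∀ x → (∁ x) ᵀ ≡ ∁ (x ᵀ)
  ᵀ-∁ x = ⊆-antisym (disjoint⇒⊆∁ (⊆-reflexive ∁xᵀ∩xᵀ≡O)) (begin
    ∁ (x ᵀ)                          ≡⟨ trans (∩-comm L _) (∩-identityʳ _) ⟨
    L ∩ ∁ (x ᵀ)                      ≡⟨ cong (_∩ ∁ (x ᵀ)) xᵀ∪∁xᵀ≡L ⟨
    (x ᵀ ∪ (∁ x) ᵀ) ∩ ∁ (x ᵀ)        ⊆⟨ [x∪y]∩∁x⊆y (x ᵀ) ((∁ x) ᵀ) ⟩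
    (∁ x) ᵀ                          ∎)
    where
    open ⊆-Reasoning
    ∁xᵀ∩xᵀ≡O : (∁ x) ᵀ ∩ x ᵀ ≡ O
    ∁xᵀ∩xᵀ≡O = trans (sym (ᵀ-∩ (∁ x) x)) (trans (cong _ᵀ (trans (∩-comm (∁ x) x) (x∩∁x≡O x))) Oᵀ≡O)
    xᵀ∪∁xᵀ≡L : x ᵀ ∪ (∁ x) ᵀ ≡ L
    xᵀ∪∁xᵀ≡L = trans (sym (ᵀ-∪ x (∁ x))) (trans (cong _ᵀ (x∪∁x≡L x)) Lᵀ≡L)

  schröderˡ : ∀ {x y z} → x ⨾ y ⊆ ∁ z → x ᵀ ⨾ z ⊆ ∁ y
  schröderˡ {x} {y} x⨾y⊆∁z = ⊆-trans (⨾-monoʳ (x ᵀ) (∁-swapʳ x⨾y⊆∁z)) (schroeder x y)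

  schröderʳ : ∀ {x y z} → x ⨾ y ⊆ ∁ z → z ⨾ y ᵀ ⊆ ∁ x
  schröderʳ {x} {y} {z} x⨾y⊆∁z =
    subst₂ _⊆_ (ᵀ-⨾-ᵀ z (y ᵀ)) (trans (ᵀ-∁ (x ᵀ)) (cong ∁ (ᵀ-involutive x)))
    (ᵀ-mono (schröderˡ (subst₂ _⊆_ (ᵀ-⨾ x y) (ᵀ-∁ z) (ᵀ-mono x⨾y⊆∁z))))

  modularʳ : ∀ x y z → x ⨾ y ∩ z ⊆ (x ∩ z ⨾ y ᵀ) ⨾ y
  modularʳ x y z = ⊆∁∪⇒∩⊆ (begin
    x ⨾ y                                  ≡⟨ cong (_⨾ y) (split x w) ⟩
    ((x ∩ ∁ w) ∪ (x ∩ w)) ⨾ y              ≡⟨ ⨾-distribʳ _ _ y ⟩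
    (x ∩ ∁ w) ⨾ y ∪ (x ∩ w) ⨾ y            ⊆⟨ ∪-mono outside-w ⊆-refl ⟩
    ∁ z ∪ (x ∩ w) ⨾ y                      ∎)
    where
    open ⊆-Reasoning
    w : Carrier
    w = z ⨾ y ᵀ
    outside-w : (x ∩ ∁ w) ⨾ y ⊆ ∁ z
    outside-w = subst₂ _⊆_ (cong ((x ∩ ∁ w) ⨾_) (ᵀ-involutive y)) refl
                  (schröderʳ (∁-swapʳ (x∩y⊆y x (∁ w))))

  modularˡ : ∀ x y z → x ⨾ y ∩ z ⊆ x ⨾ (y ∩ x ᵀ ⨾ z)
  modularˡ x y z = ⊆∁∪⇒∩⊆ (begin
    x ⨾ y                                  ≡⟨ cong (x ⨾_) (split y w) ⟩
    x ⨾ ((y ∩ ∁ w) ∪ (y ∩ w))              ≡⟨ ⨾-distribˡ x _ _ ⟩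
    x ⨾ (y ∩ ∁ w) ∪ x ⨾ (y ∩ w)            ⊆⟨ ∪-mono outside-w ⊆-refl ⟩
    ∁ z ∪ x ⨾ (y ∩ w)                      ∎)
    where
    open ⊆-Reasoning
    w : Carrier
    w = x ᵀ ⨾ z
    outside-w : x ⨾ (y ∩ ∁ w) ⊆ ∁ z
    outside-w = subst₂ _⊆_ (cong (_⨾ (y ∩ ∁ w)) (ᵀ-involutive x)) refl
                  (schröderˡ (∁-swapʳ (x∩y⊆y y (∁ w))))

  L⨾L≡L : L ⨾ L ≡ L
  L⨾L≡L = ⊆-antisym (x⊆L _) (subst₂ _⊆_ (⨾-identityʳ L) refl (⨾-monoʳ L (x⊆L I)))

  x⊆x⨾L : ∀ x → x ⊆ x ⨾ L
  x⊆x⨾L x = subst₂ _⊆_ (⨾-identityʳ x) refl (⨾-monoʳ x (x⊆L I))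

  x⨾L⨾L≡x⨾L : ∀ x → (x ⨾ L) ⨾ L ≡ x ⨾ L
  x⨾L⨾L≡x⨾L x = trans (⨾-assoc x L L) (cong (x ⨾_) L⨾L≡L)

  x⨾L⨾y≡x⨾L⨾L⨾y : ∀ x y → (x ⨾ L) ⨾ y ≡ (x ⨾ L) ⨾ (L ⨾ y)
  x⨾L⨾y≡x⨾L⨾L⨾y x y = trans (cong (_⨾ y) (sym (x⨾L⨾L≡x⨾L x))) (⨾-assoc (x ⨾ L) L y)

  O⨾x⊆O : ∀ x → O ⨾ x ⊆ O
  O⨾x⊆O x = subst₂ _⊆_ (cong (O ⨾_) (ᵀ-involutive x)) ∁L≡O
    (schröderʳ (subst₂ _⊆_ refl (sym ∁O≡L) (x⊆L (L ⨾ x ᵀ))))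

  [x⨾L]ᵀ≡L⨾xᵀ : ∀ x → (x ⨾ L) ᵀ ≡ L ⨾ x ᵀ
  [x⨾L]ᵀ≡L⨾xᵀ x = trans (ᵀ-⨾ x L) (cong (_⨾ x ᵀ) Lᵀ≡L)

  [Rᵀ⨾L⨾Sᵀ]ᵀ≡S⨾L⨾R : ∀ R S → ((R ᵀ ⨾ L) ⨾ S ᵀ) ᵀ ≡ (S ⨾ L) ⨾ R
  [Rᵀ⨾L⨾Sᵀ]ᵀ≡S⨾L⨾R R S = begin
    ((R ᵀ ⨾ L) ⨾ S ᵀ) ᵀ       ≡⟨ ᵀ-⨾ _ _ ⟩
    S ᵀ ᵀ ⨾ (R ᵀ ⨾ L) ᵀ       ≡⟨ cong₂ _⨾_ (ᵀ-involutive S) ([x⨾L]ᵀ≡L⨾xᵀ (R ᵀ)) ⟩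
    S ⨾ (L ⨾ R ᵀ ᵀ)           ≡⟨ cong (λ u → S ⨾ (L ⨾ u)) (ᵀ-involutive R) ⟩
    S ⨾ (L ⨾ R)               ≡⟨ ⨾-assoc S L R ⟨
    (S ⨾ L) ⨾ R               ∎
    where open ≡-Reasoning

  x⊆x⨾xᵀ⨾x : ∀ x → x ⊆ x ⨾ (x ᵀ ⨾ x)
  x⊆x⨾xᵀ⨾x x = begin
    x                      ≡⟨ ∩-idem x ⟨
    x ∩ x                  ≡⟨ cong (_∩ x) (⨾-identityʳ x) ⟨
    x ⨾ I ∩ x              ⊆⟨ modularˡ x I x ⟩
    x ⨾ (I ∩ x ᵀ ⨾ x)      ⊆⟨ ⨾-monoʳ x (x∩y⊆y I _) ⟩
    x ⨾ (x ᵀ ⨾ x)          ∎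
    where open ⊆-Reasoning

  x⨾L⊆x⨾xᵀ⨾L : ∀ x → x ⨾ L ⊆ x ⨾ (x ᵀ ⨾ L)
  x⨾L⊆x⨾xᵀ⨾L x = begin
    x ⨾ L                  ⊆⟨ ⨾-monoˡ L (x⊆x⨾xᵀ⨾x x) ⟩
    (x ⨾ (x ᵀ ⨾ x)) ⨾ L    ≡⟨ solve 3 (λ a b l → (a ⊕ (b ⊕ a)) ⊕ l ⊜ a ⊕ (b ⊕ (a ⊕ l)))
                                     refl x (x ᵀ) L ⟩
    x ⨾ (x ᵀ ⨾ (x ⨾ L))    ⊆⟨ ⨾-monoʳ x (⨾-monoʳ (x ᵀ) (x⊆L _)) ⟩
    x ⨾ (x ᵀ ⨾ L)          ∎
    where
    open ⊆-Reasoning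
    open ⨾-Solver

  xᵀ⨾L⊆xᵀ⨾x⨾L : ∀ x → x ᵀ ⨾ L ⊆ x ᵀ ⨾ (x ⨾ L)
  xᵀ⨾L⊆xᵀ⨾x⨾L x = subst₂ _⊆_ refl (cong (λ u → x ᵀ ⨾ (u ⨾ L)) (ᵀ-involutive x)) (x⨾L⊆x⨾xᵀ⨾L (x ᵀ))

  disjoint-domains⇒ᵀ⨾⊆O : ∀ {A B} → A ⨾ L ∩ B ⨾ L ⊆ O → A ᵀ ⨾ B ⊆ O
  disjoint-domains⇒ᵀ⨾⊆O {A} {B} disjoint = subst₂ _⊆_ refl ∁L≡O (schröderˡ A⨾L⊆∁B)
    where
    A⨾L⊆∁B : A ⨾ L ⊆ ∁ B
    A⨾L⊆∁B = ⊆-trans (disjoint⇒⊆∁ disjoint) (∁-antitone (x⊆x⨾L B))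

  disjoint-ranges⇒⨾ᵀ⊆O : ∀ {A B} → A ᵀ ⨾ L ∩ B ᵀ ⨾ L ⊆ O → A ⨾ B ᵀ ⊆ O
  disjoint-ranges⇒⨾ᵀ⊆O {A} disjoint =
    subst₂ _⊆_ (cong (_⨾ _) (ᵀ-involutive A)) refl (disjoint-domains⇒ᵀ⨾⊆O disjoint)

  ∪⨾∪⊆I : ∀ {X₁ X₂ Y₁ Y₂} → X₁ ⨾ Y₁ ⊆ I → X₁ ⨾ Y₂ ⊆ O → X₂ ⨾ Y₁ ⊆ O → X₂ ⨾ Y₂ ⊆ I →
    (X₁ ∪ X₂) ⨾ (Y₁ ∪ Y₂) ⊆ I
  ∪⨾∪⊆I {X₁} {X₂} {Y₁} {Y₂} ⊆I₁ ⊆O₁ ⊆O₂ ⊆I₂ = subst₂ _⊆_ (sym (⨾-distrib-∪ X₁ X₂ Y₁ Y₂)) refl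
    (∪-least (∪-least ⊆I₁ (⊆-trans ⊆O₁ (O⊆x I))) (∪-least (⊆-trans ⊆O₂ (O⊆x I)) ⊆I₂))

  -- Kleene star
  I⊆R* : ∀ R → I ⊆ R *
  I⊆R* R = ⊆-trans (x⊆x∪y I _) (*-unfoldˡ R)

  R⨾R*⊆R* : ∀ R → R ⨾ R * ⊆ R *
  R⨾R*⊆R* R = ⊆-trans (y⊆x∪y I _) (*-unfoldˡ R)

  R*⨾R⊆R* : ∀ R → R * ⨾ R ⊆ R *
  R*⨾R⊆R* R = ⊆-trans (y⊆x∪y I _) (*-unfoldʳ R)

  R⊆R⨾R* : ∀ R → R ⊆ R ⨾ R *
  R⊆R⨾R* R = subst₂ _⊆_ (⨾-identityʳ R) refl (⨾-monoʳ R (I⊆R* R))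

  R*⨾R*⊆R* : ∀ R → R * ⨾ R * ⊆ R *
  R*⨾R*⊆R* R = *-inductˡ R (R *) (R *) (∪-least ⊆-refl (R⨾R*⊆R* R))

  *-mono : ∀ {R S} → R ⊆ S → R * ⊆ S *
  *-mono {R} {S} R⊆S = subst₂ _⊆_ (⨾-identityʳ (R *)) refl
    (*-inductˡ R I (S *) (∪-least (I⊆R* S) (⊆-trans (⨾-monoˡ (S *) R⊆S) (R⨾R*⊆R* S))))

  R*⊆I∪R⨾R* : ∀ R → R * ⊆ I ∪ R ⨾ R *
  R*⊆I∪R⨾R* R = subst₂ _⊆_ (⨾-identityʳ (R *)) refl (*-inductˡ R I _ (∪-mono ⊆-refl R⨾[I∪R⨾R*]⊆R⨾R*))
    where
    open ⊆-Reasoning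
    R⨾[I∪R⨾R*]⊆R⨾R* : R ⨾ (I ∪ R ⨾ R *) ⊆ R ⨾ R *
    R⨾[I∪R⨾R*]⊆R⨾R* = begin
      R ⨾ (I ∪ R ⨾ R *)          ≡⟨ ⨾-distribˡ R I _ ⟩
      R ⨾ I ∪ R ⨾ (R ⨾ R *)      ≡⟨ cong (_∪ R ⨾ (R ⨾ R *)) (⨾-identityʳ R) ⟩
      R ∪ R ⨾ (R ⨾ R *)          ⊆⟨ ∪-least (R⊆R⨾R* R) (⨾-monoʳ R (R⨾R*⊆R* R)) ⟩
      R ⨾ R *                    ∎

  *-ᵀ⊆ : ∀ R → (R *) ᵀ ⊆ (R ᵀ) *
  *-ᵀ⊆ R = subst₂ _⊆_ refl (ᵀ-involutive _) (ᵀ-mono R*⊆[Rᵀ*]ᵀ)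
    where
    I⊆[Rᵀ*]ᵀ : I ⊆ ((R ᵀ) *) ᵀ
    I⊆[Rᵀ*]ᵀ = subst₂ _⊆_ Iᵀ≡I refl (ᵀ-mono (I⊆R* (R ᵀ)))
    R⨾[Rᵀ*]ᵀ⊆[Rᵀ*]ᵀ : R ⨾ ((R ᵀ) *) ᵀ ⊆ ((R ᵀ) *) ᵀ
    R⨾[Rᵀ*]ᵀ⊆[Rᵀ*]ᵀ = subst₂ _⊆_
      (trans (ᵀ-⨾ ((R ᵀ) *) (R ᵀ)) (cong (_⨾ ((R ᵀ) *) ᵀ) (ᵀ-involutive R))) refl
      (ᵀ-mono (R*⨾R⊆R* (R ᵀ)))
    R*⊆[Rᵀ*]ᵀ : R * ⊆ ((R ᵀ) *) ᵀ
    R*⊆[Rᵀ*]ᵀ = subst₂ _⊆_ (⨾-identityʳ (R *)) refl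
      (*-inductˡ R I _ (∪-least I⊆[Rᵀ*]ᵀ R⨾[Rᵀ*]ᵀ⊆[Rᵀ*]ᵀ))

  *-ᵀ : ∀ R → (R *) ᵀ ≡ (R ᵀ) *
  *-ᵀ R = ⊆-antisym (*-ᵀ⊆ R) (subst₂ _⊆_ (ᵀ-involutive _) refl
    (ᵀ-mono (subst₂ _⊆_ refl (cong _* (ᵀ-involutive R)) (*-ᵀ⊆ (R ᵀ)))))

  [R*⨾x]ᵀ≡xᵀ⨾Rᵀ* : ∀ R x → (R * ⨾ x) ᵀ ≡ x ᵀ ⨾ (R ᵀ) *
  [R*⨾x]ᵀ≡xᵀ⨾Rᵀ* R x = trans (ᵀ-⨾ (R *) x) (cong (x ᵀ ⨾_) (*-ᵀ R))

  x⨾R⊆O⇒x⨾R*⊆x : ∀ {x} R → x ⨾ R ⊆ O → x ⨾ R * ⊆ x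
  x⨾R⊆O⇒x⨾R*⊆x {x} R x⨾R⊆O = *-inductʳ R x x (∪-least ⊆-refl (⊆-trans x⨾R⊆O (O⊆x x)))

  R⨾x⊆O⇒R*⨾x⊆x : ∀ {x} R → R ⨾ x ⊆ O → R * ⨾ x ⊆ x
  R⨾x⊆O⇒R*⨾x⊆x {x} R R⨾x⊆O = *-inductˡ R x x (∪-least ⊆-refl (⊆-trans R⨾x⊆O (O⊆x x)))

  -- Vectors and tests
  IsVector : Carrier → Set ℓ
  IsVector v = v ⨾ L ≡ v

  x⨾L-isVector : ∀ x → IsVector (x ⨾ L)
  x⨾L-isVector = x⨾L⨾L≡x⨾L

  ∩-isVector : ∀ {v w} → IsVector v → IsVector w → IsVector (v ∩ w)
  ∩-isVector {v} {w} v-vec w-vec = ⊆-antisym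
    (∩-greatest (subst₂ _⊆_ refl v-vec (⨾-monoˡ L (x∩y⊆x v w)))
                (subst₂ _⊆_ refl w-vec (⨾-monoˡ L (x∩y⊆y v w))))
    (x⊆x⨾L _)

  ∁-isVector : ∀ {v} → IsVector v → IsVector (∁ v)
  ∁-isVector {v} v-vec = ⊆-antisym
    (subst₂ _⊆_ (cong (∁ v ⨾_) (ᵀ-involutive L)) refl (schröderʳ v⨾Lᵀ⊆∁∁v))
    (x⊆x⨾L _)
    where
    v⨾Lᵀ⊆∁∁v : v ⨾ L ᵀ ⊆ ∁ (∁ v)
    v⨾Lᵀ⊆∁∁v = ⊆-reflexive (trans (cong (v ⨾_) Lᵀ≡L) (trans v-vec (sym (∁-involutive v))))

  ep-isVector : ∀ R → IsVector (ep R)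
  ep-isVector R = ∩-isVector (x⨾L-isVector (R ᵀ)) (∁-isVector (x⨾L-isVector R))

  L⨾v≡L : ∀ {v} → IsVector v → ¬ (v ≡ O) → L ⨾ v ≡ L
  L⨾v≡L {v} v-vec v≢O = begin
    L ⨾ v            ≡⟨ cong (L ⨾_) v-vec ⟨
    L ⨾ (v ⨾ L)      ≡⟨ ⨾-assoc L v L ⟨
    (L ⨾ v) ⨾ L      ≡⟨ proj₁ (tarski v) v≢O ⟩
    L                ∎
    where open ≡-Reasoning

  module _ {p} (p⊆I : p ⊆ I) where

    test⨾x⊆x : ∀ x → p ⨾ x ⊆ x
    test⨾x⊆x x = subst₂ _⊆_ refl (⨾-identityˡ x) (⨾-monoˡ x p⊆I)

    x⨾test⊆x : ∀ x → x ⨾ p ⊆ x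
    x⨾test⊆x x = subst₂ _⊆_ refl (⨾-identityʳ x) (⨾-monoʳ x p⊆I)

    testᵀ⊆I : p ᵀ ⊆ I
    testᵀ⊆I = subst₂ _⊆_ refl Iᵀ≡I (ᵀ-mono p⊆I)

    test⊆testᵀ : p ⊆ p ᵀ
    test⊆testᵀ = ⊆-trans (x⊆x⨾xᵀ⨾x p) (⊆-trans (test⨾x⊆x _) (x⨾test⊆x (p ᵀ)))

  test⊆test⨾test : ∀ {p} → p ⊆ I → p ⊆ p ⨾ p
  test⊆test⨾test {p} p⊆I = ⊆-trans (x⊆x⨾xᵀ⨾x p) (⨾-monoʳ p (test⨾x⊆x (testᵀ⊆I p⊆I) p))

  testᵀ≡test : ∀ {p} → p ⊆ I → p ᵀ ≡ p
  testᵀ≡test {p} p⊆I = ⊆-antisym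
    (subst₂ _⊆_ refl (ᵀ-involutive p) (test⊆testᵀ (testᵀ⊆I p⊆I)))
    (test⊆testᵀ p⊆I)

  [I∩v]⨾L≡v : ∀ {v} → IsVector v → (I ∩ v) ⨾ L ≡ v
  [I∩v]⨾L≡v {v} v-vec = ⊆-antisym (subst₂ _⊆_ refl v-vec (⨾-monoˡ L (x∩y⊆y I v))) (begin
    v                          ≡⟨ trans (∩-comm L v) (∩-identityʳ v) ⟨
    L ∩ v                      ≡⟨ cong (_∩ v) (⨾-identityˡ L) ⟨
    I ⨾ L ∩ v                  ⊆⟨ modularʳ I L v ⟩
    (I ∩ v ⨾ L ᵀ) ⨾ L          ≡⟨ cong (λ u → (I ∩ u) ⨾ L) (trans (cong (v ⨾_) Lᵀ≡L) v-vec) ⟩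
    (I ∩ v) ⨾ L                ∎)
    where open ⊆-Reasoning

  I∩x⨾L⊆x⨾xᵀ : ∀ x → I ∩ x ⨾ L ⊆ x ⨾ x ᵀ
  I∩x⨾L⊆x⨾xᵀ x = begin
    I ∩ x ⨾ L              ≡⟨ ∩-comm I _ ⟩
    x ⨾ L ∩ I              ⊆⟨ modularˡ x L I ⟩
    x ⨾ (L ∩ x ᵀ ⨾ I)      ⊆⟨ ⨾-monoʳ x (x∩y⊆y L _) ⟩
    x ⨾ (x ᵀ ⨾ I)          ≡⟨ cong (x ⨾_) (⨾-identityʳ (x ᵀ)) ⟩
    x ⨾ x ᵀ                ∎
    where open ⊆-Reasoning

  -- Paths
  univalent⇒Rᵀ⨾R*⊆Rᵀ∪R* : ∀ {R} → Univalent R → R ᵀ ⨾ R * ⊆ R ᵀ ∪ R *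
  univalent⇒Rᵀ⨾R*⊆Rᵀ∪R* {R} univalent = begin
    R ᵀ ⨾ R *                      ⊆⟨ ⨾-monoʳ (R ᵀ) (R*⊆I∪R⨾R* R) ⟩
    R ᵀ ⨾ (I ∪ R ⨾ R *)            ≡⟨ ⨾-distribˡ (R ᵀ) I _ ⟩
    R ᵀ ⨾ I ∪ R ᵀ ⨾ (R ⨾ R *)      ≡⟨ cong₂ _∪_ (⨾-identityʳ (R ᵀ)) (sym (⨾-assoc (R ᵀ) R (R *))) ⟩
    R ᵀ ∪ (R ᵀ ⨾ R) ⨾ R *          ⊆⟨ ∪-mono ⊆-refl (test⨾x⊆x univalent (R *)) ⟩
    R ᵀ ∪ R *                      ∎
    where open ⊆-Reasoning

  module UnivalentConnected {R} (univalent : Univalent R) (connected : Connected R) where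

    P : Carrier
    P = I ∩ ep R

    P⊆I : P ⊆ I
    P⊆I = x∩y⊆x I (ep R)

    P⨾L≡ep : P ⨾ L ≡ ep R
    P⨾L≡ep = [I∩v]⨾L≡v (ep-isVector R)

    P⊆Rᵀ⨾R : P ⊆ R ᵀ ⨾ R
    P⊆Rᵀ⨾R = begin
      I ∩ ep R               ⊆⟨ ∩-mono ⊆-refl (x∩y⊆x _ _) ⟩
      I ∩ R ᵀ ⨾ L            ⊆⟨ I∩x⨾L⊆x⨾xᵀ (R ᵀ) ⟩
      R ᵀ ⨾ R ᵀ ᵀ            ≡⟨ cong (R ᵀ ⨾_) (ᵀ-involutive R) ⟩
      R ᵀ ⨾ R                ∎
      where open ⊆-Reasoning

    P⨾R⊆O : P ⨾ R ⊆ O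
    P⨾R⊆O = begin
      P ⨾ R                  ⊆⟨ x⊆x⨾L _ ⟩
      (P ⨾ R) ⨾ L            ≡⟨ ⨾-assoc P R L ⟩
      P ⨾ (R ⨾ L)            ⊆⟨ ∩-greatest (⨾-monoʳ P (x⊆L _)) (test⨾x⊆x P⊆I _) ⟩
      P ⨾ L ∩ R ⨾ L          ≡⟨ cong (_∩ R ⨾ L) P⨾L≡ep ⟩
      ep R ∩ R ⨾ L           ⊆⟨ ∩-mono (x∩y⊆y _ _) ⊆-refl ⟩
      ∁ (R ⨾ L) ∩ R ⨾ L      ≡⟨ trans (∩-comm _ _) (x∩∁x≡O _) ⟩
      O                      ∎
      where open ⊆-Reasoning

    Rᵀ⨾P⊆O : R ᵀ ⨾ P ⊆ O
    Rᵀ⨾P⊆O = ᵀ⊆O⇒⊆O (subst₂ _⊆_ P⨾R≡[Rᵀ⨾P]ᵀ refl P⨾R⊆O)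
      where
      P⨾R≡[Rᵀ⨾P]ᵀ : P ⨾ R ≡ (R ᵀ ⨾ P) ᵀ
      P⨾R≡[Rᵀ⨾P]ᵀ = sym (trans (ᵀ-⨾ (R ᵀ) P) (cong₂ _⨾_ (testᵀ≡test P⊆I) (ᵀ-involutive R)))

    -- Connectedness relates every point of the range to the end point in one of the two directions;
    -- the backward one is empty because the end point has no R-successor (R ᵀ ⨾ P ⊆ O).
    Rᵀ⨾L⨾P⊆R* : R ᵀ ⨾ L ⨾ P ⊆ R *
    Rᵀ⨾L⨾P⊆R* = begin
      (R ᵀ ⨾ L) ⨾ P
        ⊆⟨ ⨾-mono (xᵀ⨾L⊆xᵀ⨾x⨾L R) P⊆Rᵀ⨾R⨾P ⟩
      (R ᵀ ⨾ (R ⨾ L)) ⨾ (R ᵀ ⨾ (R ⨾ P))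
        ≡⟨ solve 4 (λ a b l p → (a ⊕ (b ⊕ l)) ⊕ (a ⊕ (b ⊕ p)) ⊜ a ⊕ ((((b ⊕ l) ⊕ a) ⊕ b) ⊕ p))
                 refl (R ᵀ) R L P ⟩
      R ᵀ ⨾ ((((R ⨾ L) ⨾ R ᵀ) ⨾ R) ⨾ P)
        ⊆⟨ ⨾-monoʳ (R ᵀ) (⨾-monoˡ P (⨾-monoˡ R R⨾L⨾Rᵀ⊆R⨾L)) ⟩
      R ᵀ ⨾ (((R ⨾ L) ⨾ R) ⨾ P)
        ⊆⟨ ⨾-monoʳ (R ᵀ) (⨾-monoˡ P connected) ⟩
      R ᵀ ⨾ ((R * ∪ (R ᵀ) *) ⨾ P)
        ≡⟨ trans (cong (R ᵀ ⨾_) (⨾-distribʳ _ _ P)) (⨾-distribˡ (R ᵀ) _ _) ⟩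
      R ᵀ ⨾ (R * ⨾ P) ∪ R ᵀ ⨾ ((R ᵀ) * ⨾ P)
        ⊆⟨ ∪-least forward (⊆-trans backward (O⊆x _)) ⟩
      R *  ∎
      where
      open ⊆-Reasoning
      open ⨾-Solver
      P⊆Rᵀ⨾R⨾P : P ⊆ R ᵀ ⨾ (R ⨾ P)
      P⊆Rᵀ⨾R⨾P = ⊆-trans (test⊆test⨾test P⊆I)
                   (subst₂ _⊆_ refl (⨾-assoc (R ᵀ) R P) (⨾-monoˡ P P⊆Rᵀ⨾R))
      R⨾L⨾Rᵀ⊆R⨾L : (R ⨾ L) ⨾ R ᵀ ⊆ R ⨾ L
      R⨾L⨾Rᵀ⊆R⨾L = subst₂ _⊆_ (sym (⨾-assoc R L (R ᵀ))) refl (⨾-monoʳ R (x⊆L _))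
      forward : R ᵀ ⨾ (R * ⨾ P) ⊆ R *
      forward = begin
        R ᵀ ⨾ (R * ⨾ P)            ≡⟨ ⨾-assoc _ _ P ⟨
        (R ᵀ ⨾ R *) ⨾ P            ⊆⟨ ⨾-monoˡ P (univalent⇒Rᵀ⨾R*⊆Rᵀ∪R* univalent) ⟩
        (R ᵀ ∪ R *) ⨾ P            ≡⟨ ⨾-distribʳ _ _ P ⟩
        R ᵀ ⨾ P ∪ R * ⨾ P          ⊆⟨ ∪-least (⊆-trans Rᵀ⨾P⊆O (O⊆x _)) (x⨾test⊆x P⊆I (R *)) ⟩
        R *                        ∎
      backward : R ᵀ ⨾ ((R ᵀ) * ⨾ P) ⊆ O
      backward = ⊆-trans (⨾-monoʳ (R ᵀ) (R⨾x⊆O⇒R*⨾x⊆x (R ᵀ) Rᵀ⨾P⊆O)) Rᵀ⨾P⊆O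

    ep-injective : Injective (ep R)
    ep-injective = begin
      ep R ⨾ (ep R) ᵀ            ≡⟨ cong₂ (λ u v → u ⨾ v ᵀ) P⨾L≡ep P⨾L≡ep ⟨
      (P ⨾ L) ⨾ (P ⨾ L) ᵀ        ≡⟨ cong ((P ⨾ L) ⨾_) (trans (ᵀ-⨾ P L)
                                          (cong₂ _⨾_ Lᵀ≡L (testᵀ≡test P⊆I))) ⟩
      (P ⨾ L) ⨾ (L ⨾ P)          ⊆⟨ ⨾-monoˡ (L ⨾ P) (⨾-monoˡ L (test⊆test⨾test P⊆I)) ⟩
      ((P ⨾ P) ⨾ L) ⨾ (L ⨾ P)    ≡⟨ solve 2 (λ p l → ((p ⊕ p) ⊕ l) ⊕ (l ⊕ p)
                                                  ⊜ p ⊕ (((p ⊕ l) ⊕ l) ⊕ p)) refl P L ⟩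
      P ⨾ (((P ⨾ L) ⨾ L) ⨾ P)    ≡⟨ cong (λ u → P ⨾ (u ⨾ P)) (trans (x⨾L⨾L≡x⨾L P) P⨾L≡ep) ⟩
      P ⨾ (ep R ⨾ P)             ⊆⟨ ⨾-monoʳ P (⨾-monoˡ P (x∩y⊆x _ _)) ⟩
      P ⨾ ((R ᵀ ⨾ L) ⨾ P)        ⊆⟨ ⨾-monoʳ P Rᵀ⨾L⨾P⊆R* ⟩
      P ⨾ R *                    ⊆⟨ x⨾R⊆O⇒x⨾R*⊆x R P⨾R⊆O ⟩
      P                          ⊆⟨ P⊆I ⟩
      I                          ∎
      where
      open ⊆-Reasoning
      open ⨾-Solver

    range⊆R*⨾ep : ¬ (ep R ≡ O) ⊎ R ≡ O → R ᵀ ⨾ L ⊆ R * ⨾ ep R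
    range⊆R*⨾ep (inj₂ R≡O) = begin
      R ᵀ ⨾ L          ≡⟨ cong (λ u → u ᵀ ⨾ L) R≡O ⟩
      O ᵀ ⨾ L          ≡⟨ cong (_⨾ L) Oᵀ≡O ⟩
      O ⨾ L            ⊆⟨ O⨾x⊆O L ⟩
      O                ⊆⟨ O⊆x _ ⟩
      R * ⨾ ep R       ∎
      where open ⊆-Reasoning
    range⊆R*⨾ep (inj₁ ep≢O) = begin
      R ᵀ ⨾ L                    ≡⟨ cong (R ᵀ ⨾_) (L⨾v≡L (ep-isVector R) ep≢O) ⟨
      R ᵀ ⨾ (L ⨾ ep R)           ≡⟨ ⨾-assoc _ _ _ ⟨
      (R ᵀ ⨾ L) ⨾ ep R           ⊆⟨ ⨾-monoʳ _ ep⊆P⨾ep ⟩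
      (R ᵀ ⨾ L) ⨾ (P ⨾ ep R)     ≡⟨ ⨾-assoc _ _ _ ⟨
      ((R ᵀ ⨾ L) ⨾ P) ⨾ ep R     ⊆⟨ ⨾-monoˡ _ Rᵀ⨾L⨾P⊆R* ⟩
      R * ⨾ ep R                 ∎
      where
      open ⊆-Reasoning
      ep⊆P⨾ep : ep R ⊆ P ⨾ ep R
      ep⊆P⨾ep = subst₂ _⊆_ P⨾L≡ep (trans (⨾-assoc P P L) (cong (P ⨾_) P⨾L≡ep))
                  (⨾-monoˡ L (test⊆test⨾test P⊆I))

    domain⊆R*⨾ep : ¬ (ep R ≡ O) ⊎ R ≡ O → R ⨾ L ⊆ R * ⨾ ep R
    domain⊆R*⨾ep terminating = begin
      R ⨾ L                  ⊆⟨ x⨾L⊆x⨾xᵀ⨾L R ⟩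
      R ⨾ (R ᵀ ⨾ L)          ⊆⟨ ⨾-monoʳ R (range⊆R*⨾ep terminating) ⟩
      R ⨾ (R * ⨾ ep R)       ≡⟨ ⨾-assoc _ _ _ ⟨
      (R ⨾ R *) ⨾ ep R       ⊆⟨ ⨾-monoˡ (ep R) (R⨾R*⊆R* R) ⟩
      R * ⨾ ep R             ∎
      where open ⊆-Reasoning

  ep-ᵀ : ∀ R → ep (R ᵀ) ≡ sp R
  ep-ᵀ R = cong (λ u → u ⨾ L ∩ ∁ (R ᵀ ⨾ L)) (ᵀ-involutive R)

  connected-ᵀ : ∀ {R} → Connected R → Connected (R ᵀ)
  connected-ᵀ {R} connected = begin
    (R ᵀ ⨾ L) ⨾ R ᵀ                 ≡⟨ ⨾-assoc _ _ _ ⟩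
    R ᵀ ⨾ (L ⨾ R ᵀ)                 ≡⟨ trans (ᵀ-⨾ (R ⨾ L) R) (cong (R ᵀ ⨾_) ([x⨾L]ᵀ≡L⨾xᵀ R)) ⟨
    ((R ⨾ L) ⨾ R) ᵀ                 ⊆⟨ ᵀ-mono connected ⟩
    (R * ∪ (R ᵀ) *) ᵀ               ≡⟨ trans (ᵀ-∪ _ _) (cong₂ _∪_ (*-ᵀ R) (*-ᵀ (R ᵀ))) ⟩
    (R ᵀ) * ∪ (R ᵀ ᵀ) *             ∎
    where open ⊆-Reasoning

  backward⇒forward-ᵀ : ∀ {S} → BackwardTerminating S → ForwardTerminating (S ᵀ)
  backward⇒forward-ᵀ {S} ((injective , univalent , connected) , terminating) =
    (injectiveᵀ , univalentᵀ , connected-ᵀ connected) , terminatingᵀ terminating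
    where
    injectiveᵀ : Injective (S ᵀ)
    injectiveᵀ = subst₂ _⊆_ (cong (S ᵀ ⨾_) (sym (ᵀ-involutive S))) refl univalent
    univalentᵀ : Univalent (S ᵀ)
    univalentᵀ = subst₂ _⊆_ (cong (_⨾ S ᵀ) (sym (ᵀ-involutive S))) refl injective
    terminatingᵀ : ¬ (sp S ≡ O) ⊎ S ≡ O → ¬ (ep (S ᵀ) ≡ O) ⊎ S ᵀ ≡ O
    terminatingᵀ (inj₁ sp≢O) = inj₁ (λ ep≡O → sp≢O (trans (sym (ep-ᵀ S)) ep≡O))
    terminatingᵀ (inj₂ S≡O)  = inj₂ (trans (cong _ᵀ S≡O) Oᵀ≡O)

  forward-reachable : ∀ {R} → ForwardTerminating R → R ⨾ L ⊆ R * ⨾ ep R × R ᵀ ⨾ L ⊆ R * ⨾ ep R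
  forward-reachable ((_ , univalent , connected) , terminating) =
    domain⊆R*⨾ep terminating , range⊆R*⨾ep terminating
    where open UnivalentConnected univalent connected

  backward-reachable : ∀ {S} → BackwardTerminating S → L ⨾ S ⊆ sp S ᵀ ⨾ S * × L ⨾ S ᵀ ⊆ sp S ᵀ ⨾ S *
  backward-reachable {S} backward =
      subst₂ _⊆_ (trans ([x⨾L]ᵀ≡L⨾xᵀ (S ᵀ)) (cong (L ⨾_) (ᵀ-involutive S))) refl
        (transpose (proj₁ reachableᵀ))
    , subst₂ _⊆_ (trans (cong (λ u → (u ⨾ L) ᵀ) (ᵀ-involutive S)) ([x⨾L]ᵀ≡L⨾xᵀ S)) refl
        (transpose (proj₂ reachableᵀ))
    where
    reachableᵀ : S ᵀ ⨾ L ⊆ (S ᵀ) * ⨾ ep (S ᵀ) × S ᵀ ᵀ ⨾ L ⊆ (S ᵀ) * ⨾ ep (S ᵀ)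
    reachableᵀ = forward-reachable (backward⇒forward-ᵀ backward)
    transpose : ∀ {x} → x ⊆ (S ᵀ) * ⨾ ep (S ᵀ) → x ᵀ ⊆ sp S ᵀ ⨾ S *
    transpose x⊆ = subst₂ _⊆_ refl
      (trans ([R*⨾x]ᵀ≡xᵀ⨾Rᵀ* (S ᵀ) (ep (S ᵀ)))
             (cong₂ (λ u v → u ᵀ ⨾ v *) (ep-ᵀ S) (ᵀ-involutive S)))
      (ᵀ-mono x⊆)

  -- Joining two paths
  ∪-injective : ∀ {R S} → Injective R → Injective S → R ᵀ ⨾ L ∩ S ᵀ ⨾ L ⊆ O → Injective (R ∪ S)
  ∪-injective {R} {S} injectiveR injectiveS disjoint =
    subst₂ _⊆_ (cong ((R ∪ S) ⨾_) (sym (ᵀ-∪ R S))) refl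
    (∪⨾∪⊆I injectiveR (disjoint-ranges⇒⨾ᵀ⊆O disjoint)
           (disjoint-ranges⇒⨾ᵀ⊆O (subst₂ _⊆_ (∩-comm _ _) refl disjoint)) injectiveS)

  ∪-univalent : ∀ {R S} → Univalent R → Univalent S → R ⨾ L ∩ S ⨾ L ⊆ O → Univalent (R ∪ S)
  ∪-univalent {R} {S} univalentR univalentS disjoint =
    subst₂ _⊆_ (cong (_⨾ (R ∪ S)) (sym (ᵀ-∪ R S))) refl
    (∪⨾∪⊆I univalentR (disjoint-domains⇒ᵀ⨾⊆O disjoint)
           (disjoint-domains⇒ᵀ⨾⊆O (subst₂ _⊆_ (∩-comm _ _) refl disjoint)) univalentS)

  module _ {R S} (ep≡sp : ep R ≡ sp S) (disjoint : R ⨾ L ∩ (R ᵀ ⨾ L ∪ S ⨾ L) ∩ S ᵀ ⨾ L ≡ O) where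

    below-all⇒⊆O : ∀ {X} → X ⊆ R ⨾ L → X ⊆ R ᵀ ⨾ L ∪ S ⨾ L → X ⊆ S ᵀ ⨾ L → X ⊆ O
    below-all⇒⊆O ⊆a ⊆b∪c ⊆d = ⊆-trans (∩-greatest (∩-greatest ⊆a ⊆b∪c) ⊆d) (⊆-reflexive disjoint)

    domains-disjoint : R ⨾ L ∩ S ⨾ L ⊆ O
    domains-disjoint = ⊆O-by-cases (S ᵀ ⨾ L)
      (begin
        (R ⨾ L ∩ S ⨾ L) ∩ ∁ (S ᵀ ⨾ L)   ≡⟨ ∩-assoc _ _ _ ⟩
        R ⨾ L ∩ sp S                    ≡⟨ cong (R ⨾ L ∩_) ep≡sp ⟨
        R ⨾ L ∩ ep R                    ⊆⟨ ∩-mono ⊆-refl (x∩y⊆y _ _) ⟩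
        R ⨾ L ∩ ∁ (R ⨾ L)               ≡⟨ x∩∁x≡O _ ⟩
        O                               ∎)
      (below-all⇒⊆O (⊆-trans (x∩y⊆x _ _) (x∩y⊆x _ _))
                    (⊆-trans (x∩y⊆x _ _) (⊆-trans (x∩y⊆y _ _) (y⊆x∪y _ _)))
                    (x∩y⊆y _ _))
      where open ⊆-Reasoning

    ranges-disjoint : R ᵀ ⨾ L ∩ S ᵀ ⨾ L ⊆ O
    ranges-disjoint = ⊆O-by-cases (R ⨾ L)
      (begin
        (R ᵀ ⨾ L ∩ S ᵀ ⨾ L) ∩ ∁ (R ⨾ L) ⊆⟨ ∩-greatest (∩-mono (x∩y⊆x _ _) ⊆-refl)
                                                      (⊆-trans (x∩y⊆x _ _) (x∩y⊆y _ _)) ⟩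
        ep R ∩ S ᵀ ⨾ L                  ≡⟨ cong (_∩ S ᵀ ⨾ L) ep≡sp ⟩
        sp S ∩ S ᵀ ⨾ L                  ⊆⟨ ∩-mono (x∩y⊆y _ _) ⊆-refl ⟩
        ∁ (S ᵀ ⨾ L) ∩ S ᵀ ⨾ L           ≡⟨ trans (∩-comm _ _) (x∩∁x≡O _) ⟩
        O                               ∎)
      (below-all⇒⊆O (x∩y⊆y _ _)
                    (⊆-trans (x∩y⊆x _ _) (⊆-trans (x∩y⊆x _ _) (x⊆x∪y _ _)))
                    (⊆-trans (x∩y⊆x _ _) (x∩y⊆y _ _)))
      where open ⊆-Reasoning

  through-injective : ∀ {R S E X Y} → Injective E →
    X ⊆ R * ⨾ E → Y ⊆ E ᵀ ⨾ S * → X ⨾ Y ⊆ (R ∪ S) *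
  through-injective {R} {S} {E} {X} {Y} injective X⊆R*⨾E Y⊆Eᵀ⨾S* = begin
    X ⨾ Y                              ⊆⟨ ⨾-mono X⊆R*⨾E Y⊆Eᵀ⨾S* ⟩
    (R * ⨾ E) ⨾ (E ᵀ ⨾ S *)            ≡⟨ solve 4 (λ r e f s → (r ⊕ e) ⊕ (f ⊕ s)
                                                      ⊜ r ⊕ ((e ⊕ f) ⊕ s))
                                                refl (R *) E (E ᵀ) (S *) ⟩
    R * ⨾ ((E ⨾ E ᵀ) ⨾ S *)            ⊆⟨ ⨾-monoʳ (R *) (test⨾x⊆x injective (S *)) ⟩
    R * ⨾ S *                          ⊆⟨ ⨾-mono (*-mono (x⊆x∪y R S)) (*-mono (y⊆x∪y R S)) ⟩
    (R ∪ S) * ⨾ (R ∪ S) *              ⊆⟨ R*⨾R*⊆R* (R ∪ S) ⟩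
    (R ∪ S) *                          ∎
    where
    open ⊆-Reasoning
    open ⨾-Solver

  concatenation-reachable : ∀ {R S} → ForwardTerminating R → BackwardTerminating S → ep R ≡ sp S →
    (R ⨾ L) ⨾ S ⊆ (R ∪ S) * × (R ᵀ ⨾ L) ⨾ S ᵀ ⊆ (R ∪ S) *
  concatenation-reachable {R} {S} forward@((_ , univalent , connected) , _) backward ep≡sp =
      through (proj₁ (forward-reachable forward)) (proj₁ (backward-reachable backward))
    , through (proj₂ (forward-reachable forward)) (proj₂ (backward-reachable backward))
    where
    through : ∀ {X Y} → X ⨾ L ⊆ R * ⨾ ep R → L ⨾ Y ⊆ sp S ᵀ ⨾ S * → (X ⨾ L) ⨾ Y ⊆ (R ∪ S) *
    through {X} {Y} X⨾L⊆ L⨾Y⊆ = subst₂ _⊆_ (sym (x⨾L⨾y≡x⨾L⨾L⨾y X Y)) refl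
      (through-injective (UnivalentConnected.ep-injective univalent connected) X⨾L⊆
        (subst₂ _⊆_ refl (cong (λ u → u ᵀ ⨾ S *) (sym ep≡sp)) L⨾Y⊆))

  ∪-connected : ∀ {R S} → Connected R → Connected S →
    (R ⨾ L) ⨾ S ⊆ (R ∪ S) * → (R ᵀ ⨾ L) ⨾ S ᵀ ⊆ (R ∪ S) * → Connected (R ∪ S)
  ∪-connected {R} {S} connectedR connectedS R⨾L⨾S⊆ Rᵀ⨾L⨾Sᵀ⊆ = begin
    ((R ∪ S) ⨾ L) ⨾ (R ∪ S)
      ≡⟨ trans (cong (_⨾ (R ∪ S)) (⨾-distribʳ R S L)) (⨾-distrib-∪ (R ⨾ L) (S ⨾ L) R S) ⟩
    ((R ⨾ L) ⨾ R ∪ (R ⨾ L) ⨾ S) ∪ ((S ⨾ L) ⨾ R ∪ (S ⨾ L) ⨾ S)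
      ⊆⟨ ∪-least (∪-least (within (x⊆x∪y R S) connectedR) (⊆-trans R⨾L⨾S⊆ (x⊆x∪y _ _)))
                 (∪-least (⊆-trans S⨾L⨾R⊆ (y⊆x∪y _ _)) (within (y⊆x∪y R S) connectedS)) ⟩
    (R ∪ S) * ∪ ((R ∪ S) ᵀ) *  ∎
    where
    open ⊆-Reasoning
    within : ∀ {X} → X ⊆ R ∪ S → Connected X → (X ⨾ L) ⨾ X ⊆ (R ∪ S) * ∪ ((R ∪ S) ᵀ) *
    within X⊆R∪S connected = ⊆-trans connected (∪-mono (*-mono X⊆R∪S) (*-mono (ᵀ-mono X⊆R∪S)))
    S⨾L⨾R⊆ : (S ⨾ L) ⨾ R ⊆ ((R ∪ S) ᵀ) *
    S⨾L⨾R⊆ = subst₂ _⊆_ ([Rᵀ⨾L⨾Sᵀ]ᵀ≡S⨾L⨾R R S) (*-ᵀ (R ∪ S)) (ᵀ-mono Rᵀ⨾L⨾Sᵀ⊆)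

  [∪]ᵀ⨾L : ∀ R S → (R ∪ S) ᵀ ⨾ L ≡ R ᵀ ⨾ L ∪ S ᵀ ⨾ L
  [∪]ᵀ⨾L R S = trans (cong (_⨾ L) (ᵀ-∪ R S)) (⨾-distribʳ (R ᵀ) (S ᵀ) L)

  sp-∪⊆sp : ∀ {R S} → sp S ⊆ R ᵀ ⨾ L → sp (R ∪ S) ⊆ sp R
  sp-∪⊆sp {R} {S} sp⊆range = begin
    sp (R ∪ S)
      ≡⟨ cong₂ (λ u v → u ∩ ∁ v) (⨾-distribʳ R S L) ([∪]ᵀ⨾L R S) ⟩
    (R ⨾ L ∪ S ⨾ L) ∩ ∁ (R ᵀ ⨾ L ∪ S ᵀ ⨾ L)
      ⊆⟨ ∪-difference⊆ sp⊆range ⟩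
    sp R ∎
    where open ⊆-Reasoning

  ep-∪⊆ep : ∀ {R S} → ep R ⊆ S ⨾ L → ep (R ∪ S) ⊆ ep S
  ep-∪⊆ep {R} {S} ep⊆domain = begin
    ep (R ∪ S)
      ≡⟨ cong₂ (λ u v → u ∩ ∁ v) ([∪]ᵀ⨾L R S) (⨾-distribʳ R S L) ⟩
    (R ᵀ ⨾ L ∪ S ᵀ ⨾ L) ∩ ∁ (R ⨾ L ∪ S ⨾ L)
      ≡⟨ cong₂ (λ u v → u ∩ ∁ v) (∪-comm _ _) (∪-comm _ _) ⟩
    (S ᵀ ⨾ L ∪ R ᵀ ⨾ L) ∩ ∁ (S ⨾ L ∪ R ⨾ L)
      ⊆⟨ ∪-difference⊆ ep⊆domain ⟩
    ep S ∎
    where open ⊆-Reasoning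

mainTheorem5 : {ℓ : Level} (A : KleeneRelAlg ℓ) → let open KleeneRelAlg A in
    (R S : Carrier) →
    ForwardTerminating R → BackwardTerminating S →
    ep R ≡ sp S →
    R ⨾ L ∩ ((R ᵀ) ⨾ L ∪ S ⨾ L) ∩ (S ᵀ) ⨾ L ≡ O →
    IsPath (R ∪ S) × (sp (R ∪ S) ⊆ sp R) × (ep (R ∪ S) ⊆ ep S)
mainTheorem5 A R S forward@((injectiveR , univalentR , connectedR) , _)
                   backward@((injectiveS , univalentS , connectedS) , _) ep≡sp disjoint =
    ( ∪-injective injectiveR injectiveS (ranges-disjoint ep≡sp disjoint)
    , ∪-univalent univalentR univalentS (domains-disjoint ep≡sp disjoint)
    , ∪-connected connectedR connectedS (proj₁ reachable) (proj₂ reachable) )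
  , sp-∪⊆sp (⊆-trans (⊆-reflexive (sym ep≡sp)) (x∩y⊆x _ _))
  , ep-∪⊆ep (⊆-trans (⊆-reflexive ep≡sp) (x∩y⊆x _ _))
  where
  open KleeneRelAlg A
  open Properties A
  reachable : (R ⨾ L) ⨾ S ⊆ (R ∪ S) * × (R ᵀ ⨾ L) ⨾ S ᵀ ⊆ (R ∪ S) *
  reachable = concatenation-reachable forward backward ep≡sp
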